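{- Let $\mathbb{F}$ be a field of characteristic different from $2$. Then $\alpha_{\det}(1)=\alpha_{\mathsf{perm}}(1)=0$.
   Context: $\mathsf{perm}=(\mathsf{perm}_n)$ and $\det=(\det_n)$ are the permanent and determinant of the $n\times n$ matrix $X_n=(x_{i,j})_{i,j\in[n]}$ of distinct indeterminates, with variable set $\mathcal{X}_n=\{x_{i,j}\}$. A polynomial $p$ is a simple projection of $q\in\mathbb{F}[\mathcal{Y}]$ if $p=\lambda(q\circ\phi)$ for some $\lambda\in\mathbb{F}\setminus\{0\}$ and $\phi:\mathcal{Y}\to\mathcal{X}\cup\mathbb{F}$ with $|\phi^{ -1}(x)|\le1$ for every variable $x$. For $S\subseteq\mathcal{X}$, $\Sigma_S p=p_S|_{y=0}+p_S|_{y=1}$, where $p_S$ is $p$ with every variable of $S$ replaced by one new variable $y$. For a sequence $f=(f_n)$, $\alpha_f(s)$ is the minimum integer $k$ such that for every $n$ and every $S\subseteq\mathcal{X}_n$ with $|S|\le s$, $\Sigma_S f_n$ is a simple projection of $f_{n+k}$ ($\infty$ if none exists). -}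

module Defs where

open import Level using (Level; _⊔_; suc)
open import Algebra.Bundles using (CommutativeRing)
open import Data.Nat as ℕ using (ℕ; _≤_; _<ᵇ_)
open import Data.Bool using (Bool; true; false; if_then_else_; _xor_; _∧_; not)
open import Data.Fin as Fin using (Fin; toℕ)
open import Data.Fin.Properties using (_≟_)
open import Data.Product using (_×_; _,_; Σ; ∃)
open import Data.Sum using (_⊎_; inj₁; inj₂)
open import Data.Unit using (⊤; tt)
open import Data.List as List using (List; []; _∷_; filter; length; allFin; cartesianProduct; foldr; map; concatMap)
open import Data.Vec as Vec using (Vec; lookup)
open import Relation.Nullary using (¬_; Dec; yes; no; does)
open import Relation.Binary.PropositionalEquality using (_≡_)

record Field (c ℓ : Level) : Set (Level.suc (c ⊔ ℓ)) where
  field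
    commutativeRing : CommutativeRing c ℓ
  open CommutativeRing commutativeRing public
  field
    0≉1     : ¬ (0# ≈ 1#)
    inverse : ∀ x → ¬ (x ≈ 0#) → Σ Carrier (λ y → x * y ≈ 1#)

module _ {c ℓ : Level} (F : Field c ℓ) where
  open Field F using (Carrier; _≈_; _+_; _*_; -_; 0#; 1#)

  -- The polynomial ring F[V]: the free commutative F-algebra on V,
  -- presented as syntax modulo the commutative-ring / F-algebra laws.

  data Poly (V : Set) : Set c where
    con  : Carrier → Poly V
    var  : V → Poly V
    _⊕_  : Poly V → Poly V → Poly V
    _⊗_  : Poly V → Poly V → Poly V
    ⊖_   : Poly V → Poly V

  infixl 6 _⊕_
  infixl 7 _⊗_
  infix 4 _≈ₚ_

  data _≈ₚ_ {V : Set} : Poly V → Poly V → Set (c ⊔ ℓ) where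
    ≈-refl   : ∀ {p} → p ≈ₚ p
    ≈-sym    : ∀ {p q} → p ≈ₚ q → q ≈ₚ p
    ≈-trans  : ∀ {p q r} → p ≈ₚ q → q ≈ₚ r → p ≈ₚ r
    con-cong : ∀ {a b} → a ≈ b → con a ≈ₚ con b
    ⊕-cong   : ∀ {p p' q q'} → p ≈ₚ p' → q ≈ₚ q' → p ⊕ q ≈ₚ p' ⊕ q'
    ⊗-cong   : ∀ {p p' q q'} → p ≈ₚ p' → q ≈ₚ q' → p ⊗ q ≈ₚ p' ⊗ q'
    ⊖-cong   : ∀ {p q} → p ≈ₚ q → ⊖ p ≈ₚ ⊖ q
    p⊕-assoc : ∀ p q r → (p ⊕ q) ⊕ r ≈ₚ p ⊕ (q ⊕ r)
    p⊕-comm  : ∀ p q → p ⊕ q ≈ₚ q ⊕ p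
    ⊕-idˡ    : ∀ p → con 0# ⊕ p ≈ₚ p
    ⊖-invˡ   : ∀ p → (⊖ p) ⊕ p ≈ₚ con 0#
    p⊗-assoc : ∀ p q r → (p ⊗ q) ⊗ r ≈ₚ p ⊗ (q ⊗ r)
    p⊗-comm  : ∀ p q → p ⊗ q ≈ₚ q ⊗ p
    ⊗-idˡ    : ∀ p → con 1# ⊗ p ≈ₚ p
    p-distribˡ : ∀ p q r → p ⊗ (q ⊕ r) ≈ₚ (p ⊗ q) ⊕ (p ⊗ r)
    con-+    : ∀ a b → con (a + b) ≈ₚ con a ⊕ con b
    con-*    : ∀ a b → con (a * b) ≈ₚ con a ⊗ con b
    con-‐    : ∀ a → con (- a) ≈ₚ ⊖ con a

  subst : {V W : Set} → (V → Poly W) → Poly V → Poly W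
  subst σ (con a) = con a
  subst σ (var v) = σ v
  subst σ (p ⊕ q) = subst σ p ⊕ subst σ q
  subst σ (p ⊗ q) = subst σ p ⊗ subst σ q
  subst σ (⊖ p)   = ⊖ subst σ p

  ΣP : {V : Set} → List (Poly V) → Poly V
  ΣP = foldr _⊕_ (con 0#)

  ΠP : {V : Set} → List (Poly V) → Poly V
  ΠP = foldr _⊗_ (con 1#)

  Var : ℕ → Set
  Var n = Fin n × Fin n

  allVars : (n : ℕ) → List (Var n)
  allVars n = cartesianProduct (allFin n) (allFin n)

  -- all maps Fin m → Fin n, as vectors
  allVecs : (m n : ℕ) → List (Vec (Fin n) m)
  allVecs ℕ.zero    n = Vec.[] ∷ []
  allVecs (ℕ.suc m) n = concatMap (λ i → map (i Vec.∷_) (allVecs m n)) (allFin n)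

  pairs : (n : ℕ) → List (Fin n × Fin n)
  pairs n = filter (λ ij → Fin._<?_ (Data.Product.proj₁ ij) (Data.Product.proj₂ ij)) (allVars n)
    where import Data.Product

  isInjective : {n : ℕ} → Vec (Fin n) n → Bool
  isInjective {n} σ =
    foldr _∧_ true (map (λ ij → not (does (lookup σ (proj₁ ij) ≟ lookup σ (proj₂ ij)))) (pairs n))
    where open Data.Product using (proj₁; proj₂)

  oddPerm : {n : ℕ} → Vec (Fin n) n → Bool
  oddPerm {n} σ =
    foldr _xor_ false
      (map (λ ij → does (Fin._<?_ (lookup σ (proj₂ ij)) (lookup σ (proj₁ ij)))) (pairs n))
    where open Data.Product using (proj₁; proj₂)

  perms : (n : ℕ) → List (Vec (Fin n) n)
  perms n = filter (λ σ → isInjective σ Data.Bool.≟ true) (allVecs n n)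
    where import Data.Bool

  diagMonomial : {n : ℕ} → Vec (Fin n) n → Poly (Var n)
  diagMonomial {n} σ = ΠP (map (λ i → var (i , lookup σ i)) (allFin n))

  det : (n : ℕ) → Poly (Var n)
  det n = ΣP (map (λ σ → if oddPerm σ then ⊖ diagMonomial σ else diagMonomial σ) (perms n))

  perm : (n : ℕ) → Poly (Var n)
  perm n = ΣP (map diagMonomial (perms n))

  SimpleProjection : {X Y : Set} → Poly X → Poly Y → Set (c ⊔ ℓ)
  SimpleProjection {X} {Y} p q =
    Σ Carrier λ λ' → Σ (Y → X ⊎ Carrier) λ φ →
      (¬ (λ' ≈ 0#)) ×
      (∀ (a b : Y) (x : X) → φ a ≡ inj₁ x → φ b ≡ inj₁ x → a ≡ b) ×
      (p ≈ₚ con λ' ⊗ subst (λ y → [ var , con ]′ (φ y)) q)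
    where open Data.Sum using ([_,_]′)

  -- Σ_S p : replace every variable of S by a new variable y, then
  -- p_S|_{y=0} + p_S|_{y=1}.  Subsets S of X_n are Boolean predicates.

  card : {n : ℕ} → (Var n → Bool) → ℕ
  card {n} S = length (filter (λ v → S v Data.Bool.≟ true) (allVars n))
    where import Data.Bool

  merge : {n : ℕ} → (Var n → Bool) → Poly (Var n) → Poly (Var n ⊎ ⊤)
  merge S = subst (λ v → if S v then var (inj₂ tt) else var (inj₁ v))

  setY : {n : ℕ} → Carrier → Poly (Var n ⊎ ⊤) → Poly (Var n)
  setY a = subst [ var , (λ _ → con a) ]′
    where open Data.Sum using ([_,_]′)

  ΣS : {n : ℕ} → (Var n → Bool) → Poly (Var n) → Poly (Var n)
  ΣS S p = setY 0# (merge S p) ⊕ setY 1# (merge S p)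

  Family : Set c
  Family = (n : ℕ) → Poly (Var n)

  AlphaOK : Family → ℕ → ℕ → Set (c ⊔ ℓ)
  AlphaOK f s k = ∀ (n : ℕ) (S : Var n → Bool) → card S ≤ s →
                  SimpleProjection (ΣS S (f n)) (f (n ℕ.+ k))

  AlphaIs : Family → ℕ → ℕ → Set (c ⊔ ℓ)
  AlphaIs f s k = AlphaOK f s k × (∀ k' → AlphaOK f s k' → k ≤ k')

{-# OPTIONS --safe #-}
module Submission where

-- Every monomial of det n or perm n is a product of distinct variables
-- x_{i,σ(i)}, so if S has at most one variable then f = A·y + B after
-- merging S into y, with A and B free of y.  Hence
--   Σ_S f = B + (A + B) = 2 (A/2 + B) = 2 · f[S ≔ 1/2],
-- a simple projection of f itself with λ = 2 (this is where char F ≠ 2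
-- is needed).

open import Defs
open import Level using (Level; _⊔_)
open import Data.Product using (_×_; _,_; proj₁; proj₂)
open import Relation.Nullary using (¬_)

open import Algebra.Bundles using (CommutativeRing)
open import Data.Bool using (Bool; true; false; if_then_else_; _≟_)
open import Data.Bool.Properties using (if-float; ¬-not)
open import Data.Fin using (Fin)
open import Data.List using (List; []; _∷_; map; filter; length; allFin)
open import Data.List.Membership.Propositional using (_∈_)
open import Data.List.Membership.Propositional.Properties
  using (∈-filter⁺; ∈-cartesianProduct⁺; ∈-allFin)
open import Data.List.Properties using (map-∘)
open import Data.List.Relation.Unary.All as All using (All; []; _∷_)
import Data.List.Relation.Unary.All.Properties as All
open import Data.List.Relation.Unary.AllPairs using ([]; _∷_)
open import Data.List.Relation.Unary.Any using (here)
open import Data.List.Relation.Unary.Unique.Propositional using (Unique)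
import Data.List.Relation.Unary.Unique.Propositional.Properties as Unique
open import Data.Nat using (ℕ; z≤n; s≤s; _≤_)
open import Data.Nat.Properties using (+-identityʳ)
open import Data.Sum using (_⊎_; inj₁; inj₂; [_,_]′)
open import Data.Vec using (Vec)
open import Function using (_∘_)
import Algebra.Properties.Ring as RingProperties
import Algebra.Solver.Ring.NaturalCoefficients.Default as Solver
open import Relation.Binary.PropositionalEquality as ≡
  using (_≡_; _≗_; refl; cong; cong₂)
import Relation.Binary.Reasoning.Setoid as SetoidReasoning

module _ {c ℓ : Level} (F : Field c ℓ) where
  open Field F using (Carrier; _≈_; _+_; _*_; 0#; 1#; inverse)

  infix 4 _≋_
  _≋_ : {X : Set} → Poly F X → Poly F X → Set (c ⊔ ℓ)
  _≋_ = _≈ₚ_ F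

  polyCommutativeRing : Set → CommutativeRing c (c ⊔ ℓ)
  polyCommutativeRing X = record
    { Carrier = Poly F X
    ; _≈_ = _≈ₚ_ F
    ; _+_ = _⊕_
    ; _*_ = _⊗_
    ; -_ = ⊖_
    ; 0# = con 0#
    ; 1# = con 1#
    ; isCommutativeRing = record
      { isRing = record
        { +-isAbelianGroup = record
          { isGroup = record
            { isMonoid = record
              { isSemigroup = record
                { isMagma = record
                  { isEquivalence = record { refl = ≈-refl ; sym = ≈-sym ; trans = ≈-trans }
                  ; ∙-cong = ⊕-cong }
                ; assoc = p⊕-assoc }
              ; identity = ⊕-idˡ , λ p → ≈-trans (p⊕-comm p _) (⊕-idˡ p) }
            ; inverse = ⊖-invˡ , λ p → ≈-trans (p⊕-comm p _) (⊖-invˡ p)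
            ; ⁻¹-cong = ⊖-cong }
          ; comm = p⊕-comm }
        ; *-cong = ⊗-cong
        ; *-assoc = p⊗-assoc
        ; *-identity = ⊗-idˡ , λ p → ≈-trans (p⊗-comm p _) (⊗-idˡ p)
        ; distrib = p-distribˡ , λ p q r →
            ≈-trans (p⊗-comm _ p) (≈-trans (p-distribˡ p q r) (⊕-cong (p⊗-comm p q) (p⊗-comm p r))) }
      ; *-comm = p⊗-comm } }

  subst-cong : {V W : Set} {σ τ : V → Poly F W} → σ ≗ τ → subst F σ ≗ subst F τ
  subst-cong eq (con a) = refl
  subst-cong eq (var v) = eq v
  subst-cong eq (p ⊕ q) = cong₂ _⊕_ (subst-cong eq p) (subst-cong eq q)
  subst-cong eq (p ⊗ q) = cong₂ _⊗_ (subst-cong eq p) (subst-cong eq q)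
  subst-cong eq (⊖ p)   = cong ⊖_ (subst-cong eq p)

  subst-∘ : {U V W : Set} (σ : V → Poly F W) (τ : U → Poly F V) →
            subst F σ ∘ subst F τ ≗ subst F (subst F σ ∘ τ)
  subst-∘ σ τ (con a) = refl
  subst-∘ σ τ (var v) = refl
  subst-∘ σ τ (p ⊕ q) = cong₂ _⊕_ (subst-∘ σ τ p) (subst-∘ σ τ q)
  subst-∘ σ τ (p ⊗ q) = cong₂ _⊗_ (subst-∘ σ τ p) (subst-∘ σ τ q)
  subst-∘ σ τ (⊖ p)   = cong ⊖_ (subst-∘ σ τ p)

  module _ {X : Set} (S : X → Bool) where
    private
      module R = CommutativeRing (polyCommutativeRing X)
      open Solver R.commutativeSemiring using (solve; _:+_; _:*_; _:=_)
      open SetoidReasoning R.setoid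

    assign : Carrier → X → Poly F X
    assign k v = if S v then con k else var v

    record Constant (p : Poly F X) : Set (c ⊔ ℓ) where
      constructor constant
      field
        value : Poly F X
        eval  : ∀ k → subst F (assign k) p ≋ value

    record Affine (p : Poly F X) : Set (c ⊔ ℓ) where
      constructor affine
      field
        slope intercept : Poly F X
        eval : ∀ k → subst F (assign k) p ≋ con k ⊗ slope ⊕ intercept

    constant⇒affine : ∀ {p} → Constant p → Affine p
    constant⇒affine (constant b e) = affine (con 0#) b λ k →
      R.trans (e k) (R.sym (R.trans (R.+-congʳ (R.zeroʳ (con k))) (R.+-identityˡ b)))

    var-constant : ∀ {v} → S v ≡ false → Constant (var v)
    var-constant {v} Sv = constant (var v) λ k →
      R.reflexive (cong (λ b → if b then con k else var v) Sv)

    var-affine : ∀ v → Affine (var v)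
    var-affine v with S v in Sv
    ... | false = constant⇒affine (var-constant Sv)
    ... | true  = affine (con 1#) (con 0#) λ k → begin
      subst F (assign k) (var v) ≡⟨ cong (λ b → if b then con k else var v) Sv ⟩
      con k                      ≈⟨ R.sym (R.*-identityʳ (con k)) ⟩
      con k ⊗ con 1#             ≈⟨ R.sym (R.+-identityʳ _) ⟩
      con k ⊗ con 1# ⊕ con 0#    ∎

    constant-⊗ : ∀ {p q} → Constant p → Constant q → Constant (p ⊗ q)
    constant-⊗ (constant b e) (constant b' e') = constant (b ⊗ b') λ k → ⊗-cong (e k) (e' k)

    affine-⊗-constant : ∀ {p q} → Affine p → Constant q → Affine (p ⊗ q)
    affine-⊗-constant (affine a b e) (constant q e') = affine (a ⊗ q) (b ⊗ q) λ k →
      R.trans (⊗-cong (e k) (e' k))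
        (solve 4 (λ K A B Q → (K :* A :+ B) :* Q := K :* (A :* Q) :+ B :* Q) R.refl (con k) a b q)

    constant-⊗-affine : ∀ {p q} → Constant q → Affine p → Affine (q ⊗ p)
    constant-⊗-affine (constant q e') (affine a b e) = affine (q ⊗ a) (q ⊗ b) λ k →
      R.trans (⊗-cong (e' k) (e k))
        (solve 4 (λ K A B Q → Q :* (K :* A :+ B) := K :* (Q :* A) :+ Q :* B) R.refl (con k) a b q)

    affine-⊕ : ∀ {p q} → Affine p → Affine q → Affine (p ⊕ q)
    affine-⊕ (affine a b e) (affine a' b' e') = affine (a ⊕ a') (b ⊕ b') λ k →
      R.trans (⊕-cong (e k) (e' k))
        (solve 5 (λ K A B A' B' → (K :* A :+ B) :+ (K :* A' :+ B') := K :* (A :+ A') :+ (B :+ B'))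
               R.refl (con k) a b a' b')

    affine-⊖ : ∀ {p} → Affine p → Affine (⊖ p)
    affine-⊖ (affine a b e) = affine (⊖ a) (⊖ b) λ k →
      R.trans (⊖-cong (e k))
        (R.trans (R.sym (RP.-‿+-comm _ _)) (R.+-congʳ (RP.-‿distribʳ-* _ _)))
      where module RP = RingProperties R.ring

    ΠP-var-constant : ∀ {vs} → All (λ v → S v ≡ false) vs → Constant (ΠP F (map var vs))
    ΠP-var-constant []         = constant (con 1#) λ _ → R.refl
    ΠP-var-constant (Sv ∷ Svs) = constant-⊗ (var-constant Sv) (ΠP-var-constant Svs)

    ΣP-affine : ∀ {ps} → All Affine ps → Affine (ΣP F ps)
    ΣP-affine []         = constant⇒affine (constant (con 0#) λ _ → R.refl)
    ΣP-affine (ap ∷ aps) = affine-⊕ ap (ΣP-affine aps)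

    affine-midpoint : ∀ {p} → Affine p → ∀ {a b m} → (1# + 1#) * m ≈ a + b →
      subst F (assign a) p ⊕ subst F (assign b) p ≋ con (1# + 1#) ⊗ subst F (assign m) p
    affine-midpoint {p} (affine A B e) {a} {b} {m} 2m≈a+b = begin
      subst F (assign a) p ⊕ subst F (assign b) p
        ≈⟨ ⊕-cong (e a) (e b) ⟩
      (con a ⊗ A ⊕ B) ⊕ (con b ⊗ A ⊕ B)
        ≈⟨ solve 4 (λ a b A B → (a :* A :+ B) :+ (b :* A :+ B) := (a :+ b) :* A :+ (B :+ B))
                 R.refl (con a) (con b) A B ⟩
      (con a ⊕ con b) ⊗ A ⊕ (B ⊕ B)
        ≈⟨ ⊕-cong (R.*-congʳ (R.sym (con-+ a b))) (R.sym doubling) ⟩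
      con (a + b) ⊗ A ⊕ con two ⊗ B
        ≈⟨ R.+-congʳ (R.*-congʳ (R.trans (con-cong (Field.sym F 2m≈a+b)) (con-* two m))) ⟩
      (con two ⊗ con m) ⊗ A ⊕ con two ⊗ B
        ≈⟨ R.trans (R.+-congʳ (R.*-assoc _ _ _)) (R.sym (R.distribˡ _ _ _)) ⟩
      con two ⊗ (con m ⊗ A ⊕ B)
        ≈⟨ R.*-congˡ (R.sym (e m)) ⟩
      con two ⊗ subst F (assign m) p ∎
      where
        two : Carrier
        two = 1# + 1#

        doubling : con two ⊗ B ≋ B ⊕ B
        doubling = R.trans (R.*-congʳ (con-+ 1# 1#))
                   (R.trans (R.distribʳ B _ _) (⊕-cong (⊗-idˡ B) (⊗-idˡ B)))

  Subsingleton : {X : Set} → (X → Bool) → Set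
  Subsingleton S = ∀ {v w} → S v ≡ true → S w ≡ true → v ≡ w

  module _ {X : Set} {S : X → Bool} (single : Subsingleton S) where

    ΠP-distinct-var-affine : ∀ {vs} → Unique vs → Affine S (ΠP F (map var vs))
    ΠP-distinct-var-affine {[]}     []          = constant⇒affine S (ΠP-var-constant S [])
    ΠP-distinct-var-affine {v ∷ vs} (v∉vs ∷ u) with S v in Sv
    ... | true  = affine-⊗-constant S (var-affine S v)
                    (ΠP-var-constant S (All.map (λ v≢w → ¬-not (v≢w ∘ single Sv)) v∉vs))
    ... | false = constant-⊗-affine S (var-constant S Sv) (ΠP-distinct-var-affine u)

  module _ {n : ℕ} {S : Var F n → Bool} (single : Subsingleton S) where

    diagMonomial-affine : (σ : Vec (Fin n) n) → Affine S (diagMonomial F σ)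
    diagMonomial-affine σ =
      ≡.subst (Affine S ∘ ΠP F) (≡.sym (map-∘ (allFin n)))
        (ΠP-distinct-var-affine single (Unique.map⁺ (cong proj₁) (Unique.allFin⁺ n)))

    det-affine : Affine S (det F n)
    det-affine = ΣP-affine S (All.map⁺ (All.universal signed-affine (perms F n)))
      where
        signed-affine : ∀ σ → Affine S (if oddPerm F σ then ⊖ diagMonomial F σ else diagMonomial F σ)
        signed-affine σ with oddPerm F σ
        ... | true  = affine-⊖ S (diagMonomial-affine σ)
        ... | false = diagMonomial-affine σ

    perm-affine : Affine S (perm F n)
    perm-affine = ΣP-affine S (All.map⁺ (All.universal diagMonomial-affine (perms F n)))

  length≤1⇒unique-∈ : {A : Set} {xs : List A} {x y : A} → length xs ≤ 1 → x ∈ xs → y ∈ xs → x ≡ y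
  length≤1⇒unique-∈ {xs = _ ∷ []}    _        (here refl) (here refl) = refl
  length≤1⇒unique-∈ {xs = _ ∷ _ ∷ _} (s≤s ()) _           _

  card≤1⇒subsingleton : {n : ℕ} {S : Var F n → Bool} → card F S ≤ 1 → Subsingleton S
  card≤1⇒subsingleton {n} {S} card≤1 Sv Sw = length≤1⇒unique-∈ card≤1 (∈-S Sv) (∈-S Sw)
    where
      ∈-S : ∀ {v} → S v ≡ true → v ∈ filter (λ v → S v ≟ true) (allVars F n)
      ∈-S {i , j} Sv = ∈-filter⁺ (λ v → S v ≟ true) (∈-cartesianProduct⁺ (∈-allFin i) (∈-allFin j)) Sv

  module _ {n : ℕ} (S : Var F n → Bool) where
    open SetoidReasoning (CommutativeRing.setoid (polyCommutativeRing (Var F n)))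

    setY-merge : ∀ k p → setY F k (merge F S p) ≡ subst F (assign S k) p
    setY-merge k p = ≡.trans (subst-∘ _ _ p)
      (subst-cong (λ v → if-float (subst F [ var , (λ _ → con k) ]′) (S v)) p)

    ΣS-simpleProjection : ¬ (1# + 1# ≈ 0#) → ∀ {p} → Affine S p → SimpleProjection F (ΣS F S p) p
    ΣS-simpleProjection 2≉0 {p} p-affine = 1# + 1# , φ , 2≉0 , φ-injective , (begin
      ΣS F S p
        ≡⟨ cong₂ _⊕_ (setY-merge 0# p) (setY-merge 1# p) ⟩
      subst F (assign S 0#) p ⊕ subst F (assign S 1#) p
        ≈⟨ affine-midpoint S p-affine 2·½≈0+1 ⟩
      con (1# + 1#) ⊗ subst F (assign S ½) p
        ≡⟨ cong (con (1# + 1#) ⊗_) (subst-cong (λ v → ≡.sym (if-float [ var , con ]′ (S v))) p) ⟩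
      con (1# + 1#) ⊗ subst F ([ var , con ]′ ∘ φ) p ∎)
      where
        ½ : Carrier
        ½ = proj₁ (inverse (1# + 1#) 2≉0)

        2·½≈0+1 : (1# + 1#) * ½ ≈ 0# + 1#
        2·½≈0+1 = Field.trans F (proj₂ (inverse (1# + 1#) 2≉0)) (Field.sym F (Field.+-identityˡ F 1#))

        φ : Var F n → Var F n ⊎ Carrier
        φ v = if S v then inj₂ ½ else inj₁ v

        φ-inj₁ : ∀ a {x} → φ a ≡ inj₁ x → a ≡ x
        φ-inj₁ a φa≡x with S a
        φ-inj₁ a refl | false = refl

        φ-injective : ∀ a b x → φ a ≡ inj₁ x → φ b ≡ inj₁ x → a ≡ b
        φ-injective a b x φa≡x φb≡x = ≡.trans (φ-inj₁ a φa≡x) (≡.sym (φ-inj₁ b φb≡x))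

  alphaIs-1-0 : ¬ (1# + 1# ≈ 0#) → (f : Family F) →
                (∀ {n} {S : Var F n → Bool} → Subsingleton S → Affine S (f n)) → AlphaIs F f 1 0
  alphaIs-1-0 2≉0 f f-affine = ok , λ _ _ → z≤n
    where
      ok : AlphaOK F f 1 0
      ok n S card≤1 = ≡.subst (SimpleProjection F (ΣS F S (f n)) ∘ f) (≡.sym (+-identityʳ n))
        (ΣS-simpleProjection S 2≉0 (f-affine (card≤1⇒subsingleton card≤1)))

mainTheorem6 : ∀ {c ℓ : Level} (F : Field c ℓ) →
                 ¬ (Field._≈_ F (Field._+_ F (Field.1# F) (Field.1# F)) (Field.0# F)) →
                 AlphaIs F (det F) 1 0 × AlphaIs F (perm F) 1 0
mainTheorem6 F 2≉0 = alphaIs-1-0 F 2≉0 (det F) (det-affine F) , alphaIs-1-0 F 2≉0 (perm F) (perm-affine F)
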